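{- A disconnected quiver is not mutation-equivalent to any tip, wing, or pre-fork.
   Context: A quiver is a finite directed multigraph with vertex set $Q_0$, no loops and no 2-cycles; it is disconnected if its underlying undirected graph is disconnected. $q_{ij}$ is the number of arrows $i\to j$ if positive and minus the number of arrows $j\to i$ otherwise (likewise $p_{ij},f_{ij},w_{ij},t_{ij}$). Mutation $\mu_v$: $q'_{ab}=-q_{ab}$ if $v\in\{a,b\}$, else $q'_{ab}=q_{ab}+\max(q_{av},0)\max(q_{vb},0)-\max(q_{bv},0)\max(q_{va},0)$; two quivers are mutation-equivalent if one is obtained from the other by a sequence of mutations. $Q\setminus V$ is the full subquiver on vertices not in $V$; $Q^+(v)=\{j:q_{vj}>0\}$, $Q^-(v)=\{j:q_{jv}>0\}$, $Q^k_{k'}=(Q^+(k)\cap Q^-(k'))\cup(Q^+(k')\cap Q^-(k))$. Abundant: at least two arrows between every pair of distinct vertices; acyclic: no directed cycle. Fork: an abundant, non-acyclic quiver $F$ with a vertex $r$ (point of return) such that for all $i\in F^-(r)$, $j\in F^+(r)$: $f_{ji}>f_{ir}$, $f_{ji}>f_{rj}$, and the full subquivers on $F^-(r)$, $F^+(r)$ are acyclic. Pre-fork with vertices $\{r,k,k'\}$: $k\ne k'$, $P\setminus\{k\}$ and $P\setminus\{k'\}$ forks with common point of return $r$, and each vertex $i\notin\{k,k'\}$ satisfies ($k\to i$ and $k'\to i$) or ($i\to k$ and $i\to k'$), any number of arrows between $k,k'$. Triangle condition for $X$, $k,k'$: whenever a vertex $i$ with $a,b>0$ gives either ($a$ arrows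 $k\to i$, $b$ arrows $i\to k'$, one arrow $k'\to k$) or ($a$ arrows $i\to k$, $b$ arrows $k'\to i$, one arrow $k\to k'$), then $b\ge a+2$. Wing with point of return $k$ (companion vertex $k'$): $|w_{kk'}|<2$, $W^k_{k'}=W_0\setminus\{k,k'\}$, $W\setminus\{k'\}$ a fork with point of return $k$, $W\setminus\{k\}$ abundant acyclic, triangle condition. Tip with point of return $k'$ (companion vertex $k$): $|t_{kk'}|<2$; $T\setminus\{k\}$ a fork with point of return $k'$; $T^k_{k'}=\emptyset$ if $t_{k'k}=0$, $=T^-(k')$ if $t_{k'k}=1$, $=T^+(k')$ if $t_{kk'}=1$; $T\setminus\{k'\}$ a fork with point of return $k$ if $t_{kk'}=0$ and abundant acyclic otherwise, with $k$ a source of it if $t_{k'k}=1$ and a sink if $t_{kk'}=1$; triangle condition. -}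

module Defs where

open import Data.Nat using (ℕ; _<_)
open import Data.Integer as ℤ using (ℤ; +_; 0ℤ; 1ℤ; -_; _⊔_; ∣_∣)
import Data.Integer.Base as ℤB
open import Data.Fin using (Fin; _≟_)
open import Data.Bool using (Bool; true; false; _∨_; if_then_else_)
open import Data.Product using (Σ; ∃; ∃-syntax; _×_; _,_)
open import Data.Sum using (_⊎_)
open import Relation.Nullary using (¬_; ⌊_⌋)
open import Relation.Binary.PropositionalEquality using (_≡_; _≢_)
open import Relation.Binary.Construct.Closure.ReflexiveTransitive using (Star)
open import Function.Bundles using (_⇔_)

-- A quiver on the vertex set Fin n, encoded by the skew-symmetric integer
-- matrix q : q i j = number of arrows i → j if positive,
-- minus the number of arrows j → i otherwise.
Mat : ℕ → Set
Mat n = Fin n → Fin n → ℤ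

-- no loops, no 2-cycles: encoded by q i i = 0 and skew-symmetry
IsQuiver : ∀ {n} → Mat n → Set
IsQuiver {n} q = (∀ i → q i i ≡ 0ℤ) × (∀ i j → q i j ≡ - q j i)

Arr : ∀ {n} → Mat n → Fin n → Fin n → Set
Arr q i j = ℤB._>_ (q i j) 0ℤ

pos : ℤ → ℤ
pos x = x ⊔ 0ℤ

mutate : ∀ {n} → Fin n → Mat n → Mat n
mutate v q a b =
  if ⌊ v ≟ a ⌋ ∨ ⌊ v ≟ b ⌋
  then - q a b
  else q a b ℤ.+ pos (q a v) ℤ.* pos (q v b) ℤ.- pos (q b v) ℤ.* pos (q v a)

MutStep : ∀ {n} → Mat n → Mat n → Set
MutStep {n} q q' = ∃[ v ] (∀ a b → q' a b ≡ mutate v q a b)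

MutEq : ∀ {n} → Mat n → Mat n → Set
MutEq = Star MutStep

Adj : ∀ {n} → Mat n → Fin n → Fin n → Set
Adj q i j = q i j ≢ 0ℤ

Disconnected : ∀ {n} → Mat n → Set
Disconnected q = ∃[ i ] ∃[ j ] ¬ Star (Adj q) i j

-- Full subquivers are represented by vertex subsets S : Fin n → Bool.

VSet : ℕ → Set
VSet n = Fin n → Bool

_∈ₛ_ : ∀ {n} → Fin n → VSet n → Set
i ∈ₛ S = S i ≡ true

without : ∀ {n} → Fin n → VSet n
without k i = if ⌊ k ≟ i ⌋ then false else true

all : ∀ {n} → VSet n
all _ = true

InMinus : ∀ {n} → Mat n → VSet n → Fin n → Fin n → Set
InMinus q S r i = (i ∈ₛ S) × Arr q i r

InPlus : ∀ {n} → Mat n → VSet n → Fin n → Fin n → Set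
InPlus q S r j = (j ∈ₛ S) × Arr q r j

AbundantOn : ∀ {n} → Mat n → (Fin n → Set) → Set
AbundantOn q P = ∀ i j → P i → P j → i ≢ j → 2 Data.Nat.≤ ∣ q i j ∣
  where import Data.Nat

data Path {n} (q : Mat n) (P : Fin n → Set) : Fin n → Fin n → Set where
  edge : ∀ {i j} → P i → P j → Arr q i j → Path q P i j
  cons : ∀ {i j k} → P i → Arr q i j → Path q P j k → Path q P i k

AcyclicOn : ∀ {n} → Mat n → (Fin n → Set) → Set
AcyclicOn q P = ∀ i → ¬ Path q P i i

IsForkOn : ∀ {n} → Mat n → VSet n → Fin n → Set
IsForkOn q S r =
  (r ∈ₛ S)
  × AbundantOn q (_∈ₛ S)
  × ¬ AcyclicOn q (_∈ₛ S)
  × (∀ i j → InMinus q S r i → InPlus q S r j →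
       ℤB._>_ (q j i) (q i r) × ℤB._>_ (q j i) (q r j))
  × AcyclicOn q (InMinus q S r)
  × AcyclicOn q (InPlus q S r)

InQkk' : ∀ {n} → Mat n → Fin n → Fin n → Fin n → Set
InQkk' q k k' i = (Arr q k i × Arr q i k') ⊎ (Arr q k' i × Arr q i k)

Triangle : ∀ {n} → Mat n → Fin n → Fin n → Set
Triangle q k k' = ∀ i →
  ((Arr q k i × Arr q i k' × q k' k ≡ 1ℤ) → ℤB._≥_ (q i k') (q k i ℤ.+ + 2))
  × ((Arr q i k × Arr q k' i × q k k' ≡ 1ℤ) → ℤB._≥_ (q k' i) (q i k ℤ.+ + 2))

IsPreForkWith : ∀ {n} → Mat n → Fin n → Fin n → Fin n → Set
IsPreForkWith q r k k' =
  k ≢ k'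
  × IsForkOn q (without k) r
  × IsForkOn q (without k') r
  × (∀ i → i ≢ k → i ≢ k' → (Arr q k i × Arr q k' i) ⊎ (Arr q i k × Arr q i k'))

IsPreFork : ∀ {n} → Mat n → Set
IsPreFork q = ∃[ r ] ∃[ k ] ∃[ k' ] IsPreForkWith q r k k'

IsWingWith : ∀ {n} → Mat n → Fin n → Fin n → Set
IsWingWith q k k' =
  ∣ q k k' ∣ < 2
  × (∀ i → InQkk' q k k' i ⇔ (i ≢ k × i ≢ k'))
  × IsForkOn q (without k') k
  × AbundantOn q (_∈ₛ without k) × AcyclicOn q (_∈ₛ without k)
  × Triangle q k k'

IsWing : ∀ {n} → Mat n → Set
IsWing q = ∃[ k ] ∃[ k' ] IsWingWith q k k'

IsTipWith : ∀ {n} → Mat n → Fin n → Fin n → Set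
IsTipWith q k k' =
  ∣ q k k' ∣ < 2
  × IsForkOn q (without k) k'
  × (q k' k ≡ 0ℤ → ∀ i → ¬ InQkk' q k k' i)
  × (q k' k ≡ 1ℤ → ∀ i → InQkk' q k k' i ⇔ Arr q i k')
  × (q k k' ≡ 1ℤ → ∀ i → InQkk' q k k' i ⇔ Arr q k' i)
  × (q k k' ≡ 0ℤ → IsForkOn q (without k') k)
  × (q k k' ≢ 0ℤ → AbundantOn q (_∈ₛ without k') × AcyclicOn q (_∈ₛ without k'))
  × (q k' k ≡ 1ℤ → ∀ j → j ∈ₛ without k' → ¬ Arr q j k)
  × (q k k' ≡ 1ℤ → ∀ j → j ∈ₛ without k' → ¬ Arr q k j)
  × Triangle q k k'

IsTip : ∀ {n} → Mat n → Set
IsTip q = ∃[ k ] ∃[ k' ] IsTipWith q k k'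

{-# OPTIONS --safe #-}
-- Mutation at v changes the entry between a and b only through arrows joining
-- v to both a and b, so if no arrow joins a vertex set C to its complement, the
-- same holds after any mutation; thus the component of i₀ in q, which misses j₀,
-- still splits the vertices of every quiver mutation-equivalent to q.  But a
-- tip, wing or pre-fork has two vertices k ≠ k' whose deletions both leave
-- abundant quivers, and the directed cycle avoiding k supplies a third vertex,
-- which is then joined to every other vertex, in particular across the split.
module Submission where

open import Defs
open import Data.Nat as ℕ using (ℕ)
open import Data.Integer as ℤ using (0ℤ; -_; ∣_∣)
import Data.Integer.Properties as ℤ
open import Data.Fin using (Fin; _≟_)
open import Data.Product using (∃-syntax; _×_; _,_; swap)
open import Data.Sum as ⊎ using (_⊎_; inj₁; inj₂)
open import Data.Empty using (⊥; ⊥-elim)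
open import Function using (id; _∘_)
open import Relation.Nullary using (¬_; Dec; yes; no)
open import Relation.Nullary.Decidable using (_×-dec_; decidable-stable; ¬¬-excluded-middle)
open import Relation.Binary.Definitions using (_Respects_)
open import Relation.Binary.PropositionalEquality
  using (_≡_; _≢_; refl; sym; trans; cong; subst; ≢-sym)
open import Relation.Binary.Construct.Closure.ReflexiveTransitive using (Star; ε; _◅_; _◅◅_)

private
  variable
    n : ℕ

Star-respects : ∀ {a ℓ p} {A : Set a} {T : A → A → Set ℓ} {P : A → Set p} →
                P Respects T → P Respects Star T
Star-respects resp ε        = id
Star-respects resp (s ◅ ss) = Star-respects resp ss ∘ resp s

ZeroDiagonal : Mat n → Set
ZeroDiagonal q = ∀ i → q i i ≡ 0ℤ

Unlinked : Mat n → Fin n → Fin n → Set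
Unlinked q a b = q a b ≡ 0ℤ × q b a ≡ 0ℤ

Separates : Mat n → (Fin n → Set) → Set
Separates q C = ∀ a b → C a → ¬ C b → Unlinked q a b

mutate-zeroDiagonal : (v : Fin n) (q : Mat n) → ZeroDiagonal q → ZeroDiagonal (mutate v q)
mutate-zeroDiagonal v q q-diag a with v ≟ a
... | yes _ rewrite q-diag a = refl
... | no  _ rewrite q-diag a
                  | ℤ.+-identityˡ (pos (q a v) ℤ.* pos (q v a))
  = ℤ.+-inverseʳ (pos (q a v) ℤ.* pos (q v a))

mutate-zero : (v : Fin n) (q : Mat n) (a b : Fin n) → q a b ≡ 0ℤ →
              Unlinked q a v ⊎ Unlinked q b v → mutate v q a b ≡ 0ℤ
mutate-zero v q a b qab≡0 unlinked with v ≟ a | v ≟ b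
... | yes _ | _     rewrite qab≡0 = refl
... | no  _ | yes _ rewrite qab≡0 = refl
... | no  _ | no  _ with unlinked
...   | inj₁ (qav≡0 , qva≡0) rewrite qab≡0 | qav≡0 | qva≡0 | ℤ.*-zeroʳ (pos (q b v)) = refl
...   | inj₂ (qbv≡0 , qvb≡0) rewrite qab≡0 | qbv≡0 | qvb≡0 | ℤ.*-zeroʳ (pos (q a v)) = refl

mutate-unlinked : (v : Fin n) (q : Mat n) {a b : Fin n} → Unlinked q a b →
                  Unlinked q a v ⊎ Unlinked q b v → Unlinked (mutate v q) a b
mutate-unlinked v q {a} {b} (qab≡0 , qba≡0) unlinked =
  mutate-zero v q a b qab≡0 unlinked , mutate-zero v q b a qba≡0 (⊎.swap unlinked)

MutStep-zeroDiagonal : ZeroDiagonal {n} Respects MutStep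
MutStep-zeroDiagonal {x = q} (v , q'≡μq) q-diag i =
  trans (q'≡μq i i) (mutate-zeroDiagonal v q q-diag i)

-- C need not be decidable, but Unlinked is, so a case split on C v is allowed.
MutStep-separates : (C : Fin n → Set) → (λ q → Separates q C) Respects MutStep
MutStep-separates C {q} {q'} (v , q'≡μq) sep a b a∈C b∉C =
  decidable-stable (q' a b ℤ.≟ 0ℤ ×-dec q' b a ℤ.≟ 0ℤ) λ ¬unlinked →
    ¬¬-excluded-middle λ where
      (yes v∈C) → ¬unlinked (transport (mutate-unlinked v q (sep a b a∈C b∉C)
                                          (inj₂ (swap (sep v b v∈C b∉C)))))
      (no  v∉C) → ¬unlinked (transport (mutate-unlinked v q (sep a b a∈C b∉C)
                                          (inj₁ (sep a v a∈C v∉C))))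
  where
  transport : Unlinked (mutate v q) a b → Unlinked q' a b
  transport (e₁ , e₂) = trans (q'≡μq a b) e₁ , trans (q'≡μq b a) e₂

component-separates : (q : Mat n) → IsQuiver q → (i₀ : Fin n) → Separates q (Star (Adj q) i₀)
component-separates q (_ , skew) i₀ a b i₀⇝a i₀⇝̸b with q a b ℤ.≟ 0ℤ
... | yes qab≡0 = qab≡0 , trans (skew b a) (cong -_ qab≡0)
... | no  qab≢0 = ⊥-elim (i₀⇝̸b (i₀⇝a ◅◅ (qab≢0 ◅ ε)))

∈-without : {k x : Fin n} → x ≢ k → x ∈ₛ without k
∈-without {k = k} {x} x≢k with k ≟ x
... | yes k≡x = ⊥-elim (x≢k (sym k≡x))
... | no  _   = refl

∈-without⇒≢ : {k x : Fin n} → x ∈ₛ without k → x ≢ k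
∈-without⇒≢ {k = k} {x} x∈ with k ≟ x
∈-without⇒≢ () | yes _
... | no k≢x = ≢-sym k≢x

abundant⇒adjacent : {q : Mat n} {P : Fin n → Set} → AbundantOn q P →
                    ∀ {i j} → P i → P j → i ≢ j → Adj q i j
abundant⇒adjacent abundant {i} {j} pi pj i≢j qij≡0
  with subst (λ x → 2 ℕ.≤ ∣ x ∣) qij≡0 (abundant i j pi pj i≢j)
... | ()

cycle⇒distinct-vertices : {q : Mat n} {P : Fin n → Set} → ZeroDiagonal q →
                          ∀ {i} → Path q P i i → ∃[ j ] (P i × P j × j ≢ i)
cycle⇒distinct-vertices q-diag {i} (edge _ _ qii>0) = ⊥-elim (ℤ.<-irrefl (sym (q-diag i)) qii>0)
cycle⇒distinct-vertices q-diag {i} (cons pi qij>0 path) =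
  _ , pi , start path , λ { refl → ℤ.<-irrefl (sym (q-diag i)) qij>0 }
  where
  start : ∀ {P : Fin _ → Set} {x y} → Path _ P x y → P x
  start (edge px _ _) = px
  start (cons px _ _) = px

record AbundantOffPair (q : Mat n) : Set where
  field
    k k'                : Fin n
    k≢k'                : k ≢ k'
    abundant-without-k  : AbundantOn q (_∈ₛ without k)
    abundant-without-k' : AbundantOn q (_∈ₛ without k')
    cyclic-without-k    : ¬ AcyclicOn q (_∈ₛ without k)

module _ {q : Mat n} (A : AbundantOffPair q) where
  open AbundantOffPair A

  adjacent-off-pair : ∀ {m x} → m ≢ k → m ≢ k' → m ≢ x → Adj q m x
  adjacent-off-pair {m} {x} m≢k m≢k' m≢x with x ≟ k
  ... | yes refl = abundant⇒adjacent {q = q} abundant-without-k'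
                     (∈-without m≢k') (∈-without k≢k') m≢x
  ... | no  x≢k  = abundant⇒adjacent {q = q} abundant-without-k
                     (∈-without m≢k) (∈-without x≢k) m≢x

  ¬¬third-vertex : ZeroDiagonal q → ¬ ¬ (∃[ m ] (m ≢ k × m ≢ k'))
  ¬¬third-vertex q-diag no-third = cyclic-without-k λ i cycle →
    let j , i∈ , j∈ , j≢i = cycle⇒distinct-vertices q-diag cycle in
    pick (i ≟ k') (∈-without⇒≢ i∈) (∈-without⇒≢ j∈) j≢i
    where
    pick : ∀ {i j} → Dec (i ≡ k') → i ≢ k → j ≢ k → j ≢ i → ⊥
    pick (yes refl) _   j≢k j≢i = no-third (_ , j≢k , j≢i)
    pick (no i≢k')  i≢k _   _   = no-third (_ , i≢k , i≢k')

  -- The third vertex m is joined to i₀ and to j₀, one of which lies on the other side of C.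
  no-separation : ZeroDiagonal q → {C : Fin n → Set} → Separates q C →
                  ∀ {i₀ j₀} → C i₀ → ¬ C j₀ → ⊥
  no-separation q-diag {C} sep {i₀} {j₀} i₀∈C j₀∉C =
    ¬¬third-vertex q-diag λ (m , m≢k , m≢k') → ¬¬-excluded-middle λ where
      (yes m∈C) → adjacent-off-pair m≢k m≢k' (λ { refl → j₀∉C m∈C })
                    (let qmj₀≡0 , _ = sep m j₀ m∈C j₀∉C in qmj₀≡0)
      (no  m∉C) → adjacent-off-pair m≢k m≢k' (λ { refl → m∉C i₀∈C })
                    (let _ , qmi₀≡0 = sep i₀ m i₀∈C m∉C in qmi₀≡0)

fork-abundant : {q : Mat n} {S : VSet n} {r : Fin n} → IsForkOn q S r → AbundantOn q (_∈ₛ S)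
fork-abundant (_ , abundant , _) = abundant

fork-cyclic : {q : Mat n} {S : VSet n} {r : Fin n} → IsForkOn q S r → ¬ AcyclicOn q (_∈ₛ S)
fork-cyclic (_ , _ , cyclic , _) = cyclic

fork-≢ : {q : Mat n} {k r : Fin n} → IsForkOn q (without k) r → r ≢ k
fork-≢ (r∈ , _) = ∈-without⇒≢ r∈

tip⇒abundantOffPair : {q : Mat n} → IsTip q → AbundantOffPair q
tip⇒abundantOffPair {q = q} (k , k' , _ , fork , _ , _ , _ , fork' , abundant-acyclic' , _) =
  record { k = k ; k' = k' ; k≢k' = ≢-sym (fork-≢ fork)
         ; abundant-without-k = fork-abundant fork
         ; abundant-without-k' = abundant'
         ; cyclic-without-k = fork-cyclic fork }
  where
  abundant' : AbundantOn q (_∈ₛ without k')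
  abundant' with q k k' ℤ.≟ 0ℤ
  ... | yes qkk'≡0 = fork-abundant (fork' qkk'≡0)
  ... | no  qkk'≢0 = let abundant , _ = abundant-acyclic' qkk'≢0 in abundant

wing⇒abundantOffPair : {q : Mat n} → IsWing q → AbundantOffPair q
wing⇒abundantOffPair (k , k' , _ , _ , fork , abundant , _) =
  record { k = k' ; k' = k ; k≢k' = ≢-sym (fork-≢ fork)
         ; abundant-without-k = fork-abundant fork
         ; abundant-without-k' = abundant
         ; cyclic-without-k = fork-cyclic fork }

preFork⇒abundantOffPair : {q : Mat n} → IsPreFork q → AbundantOffPair q
preFork⇒abundantOffPair (_ , k , k' , k≢k' , fork , fork' , _) =
  record { k = k ; k' = k' ; k≢k' = k≢k'
         ; abundant-without-k = fork-abundant fork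
         ; abundant-without-k' = fork-abundant fork'
         ; cyclic-without-k = fork-cyclic fork }

corollary5p6 : (n : ℕ) (q p : Mat n) → IsQuiver q → Disconnected q → MutEq q p →
                 ¬ (IsTip p ⊎ IsWing p ⊎ IsPreFork p)
corollary5p6 n q p q-quiver (i₀ , j₀ , i₀⇝̸j₀) q~p shape =
  no-separation (abundantOffPair shape) p-diag p-sep ε i₀⇝̸j₀
  where
  C : Fin n → Set
  C = Star (Adj q) i₀
  p-diag : ZeroDiagonal p
  p-diag = Star-respects MutStep-zeroDiagonal q~p (let q-diag , _ = q-quiver in q-diag)
  p-sep : Separates p C
  p-sep = Star-respects (MutStep-separates C) q~p (component-separates q q-quiver i₀)
  abundantOffPair : IsTip p ⊎ IsWing p ⊎ IsPreFork p → AbundantOffPair p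
  abundantOffPair (inj₁ tip)         = tip⇒abundantOffPair tip
  abundantOffPair (inj₂ (inj₁ wing)) = wing⇒abundantOffPair wing
  abundantOffPair (inj₂ (inj₂ pre))  = preFork⇒abundantOffPair pre
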